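{- Let $n\ge1$, $\mathcal B_n=\{e_i:1\le i\le n\}\cup\{e_i\pm e_j:1\le i<j\le n\}\subset V=\mathbb{R}^n$. Let $P^+,P^-$ be disjoint subsets of $\{1,\dots,n\}$, not both empty, let $Z$ be the complement of $P^+\cup P^-$, and set $H_P=\{v\in V:\sum_{i\in P^+}v_i-\sum_{j\in P^- }v_j=0\}$, $\mathcal B(Z)=\{e_i:i\in Z\}\cup\{e_i\pm e_j:i<j,\ i,j\in Z\}$, $\mathcal K(P^+,P^-)=\{e_i-e_j:i<j,\ i,j\in P^+\}\cup\{e_i+e_k:i\in P^+,k\in P^-\}\cup\{e_k-e_\ell:k<\ell,\ k,\ell\in P^-\}$. Then: (i) $H_P$ is a $\mathcal B_n$-admissible hyperplane; (ii) $\mathcal B_n\cap H_P=\mathcal B(Z)\cup\mathcal K(P^+,P^-)$; (iii) every $\mathcal B_n$-admissible hyperplane equals $H_P$ for some such pair $(P^+,P^-)$.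
   Context: $e_1,\dots,e_n$ is the standard basis of $\mathbb{R}^n$. A hyperplane of $V$ is $\mathcal B_n$-admissible if it is spanned by a set of elements of $\mathcal B_n$.
   Formalization: The space V is ℚ^n instead of ℝ^n, with spans, linear functionals and hyperplanes all taken over the rationals. -}

module Defs where

open import Data.Nat using (ℕ; zero; suc)
open import Data.Fin using (Fin; zero; suc; _<_; _≟_)
open import Data.Fin.Subset using (Subset; _∈_; _∉_)
open import Data.Vec using ([]; _∷_)
open import Data.Bool using (true; false; if_then_else_)
open import Data.Rational using (ℚ; 0ℚ; 1ℚ; _+_; _-_; _*_)
open import Data.Product using (Σ; ∃; ∃-syntax; _×_)
open import Data.Sum using (_⊎_)
open import Relation.Nullary using (¬_; does)
open import Relation.Binary.PropositionalEquality using (_≡_; _≢_; _≗_)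
open import Function using (_∘_)
open import Function.Bundles using (_⇔_)

-- The ambient space V = ℚ^n (stand-in for ℝ^n), vectors as functions.
V : ℕ → Set
V n = Fin n → ℚ

e : ∀ {n} → Fin n → V n
e i j = if does (i ≟ j) then 1ℚ else 0ℚ

_⊕_ : ∀ {n} → V n → V n → V n
(u ⊕ w) j = u j + w j

_⊖_ : ∀ {n} → V n → V n → V n
(u ⊖ w) j = u j - w j

_·_ : ∀ {n} → ℚ → V n → V n
(c · u) j = c * u j

zeroV : ∀ {n} → V n
zeroV j = 0ℚ

sumAll : ∀ {n} → V n → ℚ
sumAll {zero} v = 0ℚ
sumAll {suc n} v = v zero + sumAll (v ∘ suc)

sumSub : ∀ {n} → Subset n → V n → ℚ
sumSub [] v = 0ℚ
sumSub (true ∷ p) v = v zero + sumSub p (v ∘ suc)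
sumSub (false ∷ p) v = sumSub p (v ∘ suc)

linComb : ∀ {n m} → (Fin m → ℚ) → (Fin m → V n) → V n
linComb {m = zero} c S = zeroV
linComb {m = suc m} c S = (c zero · S zero) ⊕ linComb (c ∘ suc) (S ∘ suc)

Pred : ℕ → Set₁
Pred n = V n → Set

Span : ∀ {n m} → (Fin m → V n) → Pred n
Span S v = ∃[ c ] (v ≗ linComb c S)

Hyperplane : ∀ {n} → Pred n → Set
Hyperplane {n} W =
  Σ (V n) λ a → ((∃[ i ] a i ≢ 0ℚ) × (∀ (v : V n) → W v ⇔ (sumAll (λ i → a i * v i) ≡ 0ℚ)))

InB : ∀ {n} → Pred n
InB v = (∃[ i ] v ≗ e i)
      ⊎ (∃[ i ] ∃[ j ] (i < j × (v ≗ (e i ⊕ e j) ⊎ v ≗ (e i ⊖ e j))))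

Admissible : ∀ {n} → Pred n → Set
Admissible {n} W =
  Hyperplane W ×
  (Σ ℕ λ m → Σ (Fin m → V n) λ S → ((∀ (k : Fin m) → InB (S k)) × (∀ (v : V n) → W v ⇔ Span S v)))

H : ∀ {n} → Subset n → Subset n → Pred n
H P⁺ P⁻ v = sumSub P⁺ v - sumSub P⁻ v ≡ 0ℚ

Disjoint : ∀ {n} → Subset n → Subset n → Set
Disjoint P⁺ P⁻ = ∀ i → ¬ (i ∈ P⁺ × i ∈ P⁻)

NotBothEmpty : ∀ {n} → Subset n → Subset n → Set
NotBothEmpty P⁺ P⁻ = ∃[ i ] (i ∈ P⁺ ⊎ i ∈ P⁻)

InZ : ∀ {n} → Subset n → Subset n → Fin n → Set
InZ P⁺ P⁻ i = i ∉ P⁺ × i ∉ P⁻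

InBZ : ∀ {n} → Subset n → Subset n → Pred n
InBZ P⁺ P⁻ v =
    (∃[ i ] (InZ P⁺ P⁻ i × v ≗ e i))
  ⊎ (∃[ i ] ∃[ j ] (i < j × InZ P⁺ P⁻ i × InZ P⁺ P⁻ j
                    × (v ≗ (e i ⊕ e j) ⊎ v ≗ (e i ⊖ e j))))

InK : ∀ {n} → Subset n → Subset n → Pred n
InK P⁺ P⁻ v =
    (∃[ i ] ∃[ j ] (i < j × i ∈ P⁺ × j ∈ P⁺ × v ≗ (e i ⊖ e j)))
  ⊎ (∃[ i ] ∃[ k ] (i ∈ P⁺ × k ∈ P⁻ × v ≗ (e i ⊕ e k)))
  ⊎ (∃[ k ] ∃[ l ] (k < l × k ∈ P⁻ × l ∈ P⁻ × v ≗ (e k ⊖ e l)))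

{-# OPTIONS --safe #-}
-- H_P is the kernel of the {0,±1}-vector χ = 1_{P⁺} − 1_{P⁻}, which is ±1 at some pivot p.
-- The vectors e_k − χ_p χ_k e_p (k ≠ p) span this kernel and are, up to sign, elements of B_n;
-- this gives (i), and (ii) is a case check on the values of χ at the indices of e_i, e_i ± e_j.
-- For (iii), let a be a normal vector of an admissible W with a_i ≠ 0. Each element of B_n in W
-- forces a_k = 0, a_k = a_l or a_k = −a_l, relations preserved by every odd g : ℚ → ℚ,
-- so g ∘ a also vanishes on W and is therefore proportional to a. Taking
-- g(x) = x·[x² = a_j²] yields a_j = 0 or a_j = ±a_i, i.e. a = a_i χ for suitable P⁺, P⁻.
module Submission where

open import Defs
open import Data.Nat using (ℕ; _≤_; suc)
open import Data.Fin using (Fin; zero; suc; _≟_; punchIn)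
open import Data.Fin.Properties using (punchInᵢ≢i; <-cmp)
open import Relation.Binary.Definitions using (tri<; tri≈; tri>)
open import Data.Rational using (ℚ; 0ℚ; 1ℚ; _+_; _-_; _*_; -_; 1/_; ≢-nonZero)
  renaming (_≟_ to _≟ℚ_)
import Data.Rational.Properties as ℚ
open import Data.Rational.Solver using (module +-*-Solver)
open import Algebra.Bundles using (CommutativeRing)
open import Algebra.Properties.Group ℚ.+-0-group using (inverseˡ-unique; inverseʳ-unique; x∙y⁻¹≈ε⇒x≈y)
open import Algebra.Properties.Semiring.Sum (CommutativeRing.semiring ℚ.+-*-commutativeRing)
  using (sum; sum-cong-≗; sum-remove; ∑-distrib-+; *-distribˡ-sum; sum-replicate-zero)
open import Data.Fin.Subset using (Subset; _∈_; _∉_)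
open import Data.Vec using ([]; _∷_; lookup; tabulate)
open import Data.Vec.Properties using ([]=⇒lookup; lookup⇒[]=; lookup∘tabulate)
open import Data.Bool using (Bool; true; false; if_then_else_)
open import Data.Product using (∃-syntax; _×_; _,_; proj₁; proj₂; map₂)
open import Data.Sum using (_⊎_; inj₁; inj₂; [_,_]′)
open import Data.Empty using (⊥; ⊥-elim)
open import Relation.Nullary using (does; yes; no)
open import Relation.Nullary.Decidable using (dec-true; dec-false)
open import Relation.Binary.PropositionalEquality
open import Function using (_∘_)
open import Function.Bundles using (_⇔_; mk⇔; Equivalence)
import Function.Properties.Equivalence as ⇔

open +-*-Solver
open ≡-Reasoning

private
  variable
    n m : ℕ

x*y≡0⇒y≡0 : ∀ {x y} → x ≢ 0ℚ → x * y ≡ 0ℚ → y ≡ 0ℚ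
x*y≡0⇒y≡0 {x} {y} x≢0 xy≡0 = begin
  y                ≡⟨ sym (ℚ.*-identityˡ y) ⟩
  1ℚ * y           ≡⟨ cong (_* y) (sym (ℚ.*-inverseˡ x)) ⟩
  (1/ x * x) * y   ≡⟨ ℚ.*-assoc (1/ x) x y ⟩
  1/ x * (x * y)   ≡⟨ cong (1/ x *_) xy≡0 ⟩
  1/ x * 0ℚ        ≡⟨ ℚ.*-zeroʳ (1/ x) ⟩
  0ℚ               ∎
  where instance _ = ≢-nonZero x≢0

x≡-x⇒x≡0 : ∀ {x} → x ≡ - x → x ≡ 0ℚ
x≡-x⇒x≡0 {x} x≡-x = x*y≡0⇒y≡0 {1ℚ + 1ℚ} (λ ()) (begin
  (1ℚ + 1ℚ) * x  ≡⟨ solve 1 (λ x → (con 1ℚ :+ con 1ℚ) :* x := x :+ x) refl x ⟩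
  x + x          ≡⟨ cong (x +_) x≡-x ⟩
  x + - x        ≡⟨ ℚ.+-inverseʳ x ⟩
  0ℚ             ∎)

x*x≡y*y⇒x≡±y : ∀ {x y} → x * x ≡ y * y → x ≡ y ⊎ x ≡ - y
x*x≡y*y⇒x≡±y {x} {y} xx≡yy with x - y ≟ℚ 0ℚ
... | yes x-y≡0 = inj₁ (x∙y⁻¹≈ε⇒x≈y x y x-y≡0)
... | no  x-y≢0 = inj₂ (inverseˡ-unique x y (x*y≡0⇒y≡0 x-y≢0 difference-of-squares))
  where
  difference-of-squares : (x - y) * (x + y) ≡ 0ℚ
  difference-of-squares = begin
    (x - y) * (x + y)  ≡⟨ solve 2 (λ x y → (x :- y) :* (x :+ y) := x :* x :- y :* y) refl x y ⟩
    x * x - y * y      ≡⟨ cong (_- y * y) xx≡yy ⟩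
    y * y - y * y      ≡⟨ ℚ.+-inverseʳ (y * y) ⟩
    0ℚ                 ∎

-- Dot products and spans

sumAll≡sum : (v : V n) → sumAll v ≡ sum v
sumAll≡sum {ℕ.zero} v = refl
sumAll≡sum {suc n} v = cong (v zero +_) (sumAll≡sum (v ∘ suc))

sum-zero : (f : Fin n → ℚ) → (∀ k → f k ≡ 0ℚ) → sum f ≡ 0ℚ
sum-zero {n} f f≗0 = trans (sum-cong-≗ f≗0) (sum-replicate-zero n)

dot : V n → V n → ℚ
dot a v = sum (λ k → a k * v k)

dot-comm : (a v : V n) → dot a v ≡ dot v a
dot-comm a v = sum-cong-≗ (λ k → ℚ.*-comm (a k) (v k))

dot-cong : (a : V n) {v w : V n} → v ≗ w → dot a v ≡ dot a w
dot-cong a v≗w = sum-cong-≗ (λ k → cong (a k *_) (v≗w k))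

dot-zeroV : (a : V n) → dot a zeroV ≡ 0ℚ
dot-zeroV a = sum-zero (λ k → a k * 0ℚ) (λ k → ℚ.*-zeroʳ (a k))

dot-⊕ : (a u w : V n) → dot a (u ⊕ w) ≡ dot a u + dot a w
dot-⊕ a u w = trans (sum-cong-≗ (λ k → ℚ.*-distribˡ-+ (a k) (u k) (w k)))
                    (∑-distrib-+ (λ k → a k * u k) (λ k → a k * w k))

dot-· : (a : V n) (c : ℚ) (u : V n) → dot a (c · u) ≡ c * dot a u
dot-· a c u = begin
  sum (λ k → a k * (c * u k))
    ≡⟨ sum-cong-≗ (λ k → solve 3 (λ a c u → a :* (c :* u) := c :* (a :* u)) refl (a k) c (u k)) ⟩
  sum (λ k → c * (a k * u k))  ≡⟨ *-distribˡ-sum c (λ k → a k * u k) ⟨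
  c * dot a u                  ∎

dot-⊖ : (a u w : V n) → dot a (u ⊖ w) ≡ dot a u - dot a w
dot-⊖ a u w = begin
  dot a (u ⊖ w)
    ≡⟨ dot-cong a (λ k → solve 2 (λ u w → u :- w := u :+ con (- 1ℚ) :* w) refl (u k) (w k)) ⟩
  dot a (u ⊕ ((- 1ℚ) · w))               ≡⟨ dot-⊕ a u ((- 1ℚ) · w) ⟩
  dot a u + dot a ((- 1ℚ) · w)            ≡⟨ cong (dot a u +_) (dot-· a (- 1ℚ) w) ⟩
  dot a u + - 1ℚ * dot a w                ≡⟨ solve 2 (λ x y → x :+ con (- 1ℚ) :* y := x :- y) refl (dot a u) (dot a w) ⟩
  dot a u - dot a w                       ∎

dot≡0⇔sumAll≡0 : (a v : V n) → (dot a v ≡ 0ℚ) ⇔ (sumAll (λ i → a i * v i) ≡ 0ℚ)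
dot≡0⇔sumAll≡0 {n} a v = mk⇔ (trans (sumAll≡sum av)) (trans (sym (sumAll≡sum av)))
  where
  av : V n
  av i = a i * v i

e-diag : (i : Fin n) → e i i ≡ 1ℚ
e-diag i = cong (if_then 1ℚ else 0ℚ) (dec-true (i ≟ i) refl)

e-off-diag : {i j : Fin n} → i ≢ j → e i j ≡ 0ℚ
e-off-diag {i = i} {j} i≢j = cong (if_then 1ℚ else 0ℚ) (dec-false (i ≟ j) i≢j)

e-comm : (i j : Fin n) → e i j ≡ e j i
e-comm i j with i ≟ j
... | yes refl = sym (e-diag i)
... | no  i≢j  = sym (e-off-diag (i≢j ∘ sym))

dot-e : (a : V n) (i : Fin n) → dot a (e i) ≡ a i
dot-e {n = suc n} a i = begin
  dot a (e i)                                   ≡⟨ sum-remove {i = i} (λ k → a k * e i k) ⟩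
  a i * e i i + sum (λ k → a (i′ k) * e i (i′ k)) ≡⟨ cong₂ _+_ (cong (a i *_) (e-diag i)) (sum-zero _ off-diagonal) ⟩
  a i * 1ℚ + 0ℚ                                 ≡⟨ solve 1 (λ x → x :* con 1ℚ :+ con 0ℚ := x) refl (a i) ⟩
  a i                                           ∎
  where
  i′ : Fin n → Fin (suc n)
  i′ = punchIn i

  off-diagonal : ∀ k → a (i′ k) * e i (i′ k) ≡ 0ℚ
  off-diagonal k = trans (cong (a (i′ k) *_) (e-off-diag (punchInᵢ≢i i k ∘ sym))) (ℚ.*-zeroʳ (a (i′ k)))

dot-e⊕e : (a : V n) (i j : Fin n) → dot a (e i ⊕ e j) ≡ a i + a j
dot-e⊕e a i j = trans (dot-⊕ a (e i) (e j)) (cong₂ _+_ (dot-e a i) (dot-e a j))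

dot-e⊖e : (a : V n) (i j : Fin n) → dot a (e i ⊖ e j) ≡ a i - a j
dot-e⊖e a i j = trans (dot-⊖ a (e i) (e j)) (cong₂ _-_ (dot-e a i) (dot-e a j))

⊕-comm : (u w : V n) → u ⊕ w ≗ w ⊕ u
⊕-comm u w k = ℚ.+-comm (u k) (w k)

linComb-coord : (c : Fin m → ℚ) (S : Fin m → V n) (j : Fin n) → linComb c S j ≡ sum (λ k → c k * S k j)
linComb-coord {m = ℕ.zero} c S j = refl
linComb-coord {m = suc m}  c S j = cong (c zero * S zero j +_) (linComb-coord (c ∘ suc) (S ∘ suc) j)

∈-Span : (S : Fin m → V n) (k : Fin m) → Span S (S k)
∈-Span S k = e k , λ j → sym (begin
  linComb (e k) S j          ≡⟨ linComb-coord (e k) S j ⟩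
  dot (e k) (λ l → S l j)    ≡⟨ dot-comm (e k) (λ l → S l j) ⟩
  dot (λ l → S l j) (e k)    ≡⟨ dot-e (λ l → S l j) k ⟩
  S k j                      ∎)

Span-rescale : (σ : Fin m → ℚ) → (∀ k → σ k * σ k ≡ 1ℚ) → {S : Fin m → V n} {v : V n} →
               Span S v → Span (λ k → σ k · S k) v
Span-rescale σ σ²≡1 {S} {v} (c , v≗cS) = (λ k → σ k * c k) , λ j → begin
  v j                                             ≡⟨ v≗cS j ⟩
  linComb c S j                                   ≡⟨ linComb-coord c S j ⟩
  sum (λ k → c k * S k j)                         ≡⟨ sum-cong-≗ (λ k → cancel-σ² k (S k j)) ⟩
  sum (λ k → (σ k * c k) * (σ k * S k j))         ≡⟨ linComb-coord (λ k → σ k * c k) (λ k → σ k · S k) j ⟨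
  linComb (λ k → σ k * c k) (λ k → σ k · S k) j   ∎
  where
  cancel-σ² : ∀ k x → c k * x ≡ (σ k * c k) * (σ k * x)
  cancel-σ² k x = begin
    c k * x                        ≡⟨ solve 2 (λ c x → c :* x := con 1ℚ :* (c :* x)) refl (c k) x ⟩
    1ℚ * (c k * x)                 ≡⟨ cong (_* (c k * x)) (σ²≡1 k) ⟨
    (σ k * σ k) * (c k * x)        ≡⟨ solve 3 (λ s c x → (s :* s) :* (c :* x) := (s :* c) :* (s :* x)) refl (σ k) (c k) x ⟩
    (σ k * c k) * (σ k * x)        ∎

dot-linComb≡0 : (a : V n) (c : Fin m → ℚ) (S : Fin m → V n) → (∀ k → dot a (S k) ≡ 0ℚ) →
                dot a (linComb c S) ≡ 0ℚ
dot-linComb≡0 {m = ℕ.zero} a c S _ = dot-zeroV a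
dot-linComb≡0 {m = suc m}  a c S aS≡0 = begin
  dot a ((c zero · S zero) ⊕ linComb (c ∘ suc) (S ∘ suc))
    ≡⟨ dot-⊕ a (c zero · S zero) (linComb (c ∘ suc) (S ∘ suc)) ⟩
  dot a (c zero · S zero) + dot a (linComb (c ∘ suc) (S ∘ suc))
    ≡⟨ cong₂ _+_ (dot-· a (c zero) (S zero)) (dot-linComb≡0 a (c ∘ suc) (S ∘ suc) (aS≡0 ∘ suc)) ⟩
  c zero * dot a (S zero) + 0ℚ
    ≡⟨ cong (λ x → c zero * x + 0ℚ) (aS≡0 zero) ⟩
  c zero * 0ℚ + 0ℚ
    ≡⟨ solve 1 (λ c → c :* con 0ℚ :+ con 0ℚ := con 0ℚ) refl (c zero) ⟩
  0ℚ ∎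

Span⊆kernel : (a : V n) {S : Fin m → V n} → (∀ k → dot a (S k) ≡ 0ℚ) → ∀ {v} → Span S v → dot a v ≡ 0ℚ
Span⊆kernel a {S} aS≡0 (c , v≗cS) = trans (dot-cong a v≗cS) (dot-linComb≡0 a c S aS≡0)

-- Kernels of linear functionals

kernelBasis : (a : V (suc n)) (p : Fin (suc n)) (t : ℚ) → Fin n → V (suc n)
kernelBasis a p t k = e (punchIn p k) ⊖ ((t * a (punchIn p k)) · e p)

module _ (a : V (suc n)) (p : Fin (suc n)) (t : ℚ) (t*ap≡1 : t * a p ≡ 1ℚ) where

  kernelBasis⊆kernel : (k : Fin n) → dot a (kernelBasis a p t k) ≡ 0ℚ
  kernelBasis⊆kernel k = begin
    dot a (e k′ ⊖ ((t * a k′) · e p))          ≡⟨ dot-⊖ a (e k′) ((t * a k′) · e p) ⟩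
    dot a (e k′) - dot a ((t * a k′) · e p)
      ≡⟨ cong₂ _-_ (dot-e a k′) (trans (dot-· a (t * a k′) (e p)) (cong (t * a k′ *_) (dot-e a p))) ⟩
    a k′ - t * a k′ * a p
      ≡⟨ solve 3 (λ x t y → x :- t :* x :* y := x :* (con 1ℚ :- t :* y)) refl (a k′) t (a p) ⟩
    a k′ * (1ℚ - t * a p)                      ≡⟨ cong (λ y → a k′ * (1ℚ - y)) t*ap≡1 ⟩
    a k′ * (1ℚ - 1ℚ)                           ≡⟨ ℚ.*-zeroʳ (a k′) ⟩
    0ℚ                                         ∎
    where
    k′ : Fin (suc n)
    k′ = punchIn p k

  kernel⊆Span-kernelBasis : {v : V (suc n)} → dot a v ≡ 0ℚ → Span (kernelBasis a p t) v
  kernel⊆Span-kernelBasis {v} av≡0 = v ∘ punchIn p , λ j → sym (expand j)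
    where
    expand : ∀ j → linComb (v ∘ punchIn p) (kernelBasis a p t) j ≡ v j
    expand j = begin
      linComb (v ∘ punchIn p) (kernelBasis a p t) j  ≡⟨ linComb-coord (v ∘ punchIn p) (kernelBasis a p t) j ⟩
      sum (f ∘ punchIn p)                             ≡⟨ ℚ.+-identityˡ _ ⟨
      0ℚ + sum (f ∘ punchIn p)                        ≡⟨ cong (_+ sum (f ∘ punchIn p)) f[p]≡0 ⟨
      f p + sum (f ∘ punchIn p)                       ≡⟨ sum-remove {i = p} f ⟨
      sum f                                           ≡⟨ sum-cong-≗ split ⟩
      sum (λ k → v k * e j k + - (t * e p j) * (a k * v k))
        ≡⟨ ∑-distrib-+ (λ k → v k * e j k) (λ k → - (t * e p j) * (a k * v k)) ⟩
      dot v (e j) + sum (λ k → - (t * e p j) * (a k * v k))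
        ≡⟨ cong₂ _+_ (dot-e v j) (sym (*-distribˡ-sum (- (t * e p j)) (λ k → a k * v k))) ⟩
      v j + - (t * e p j) * dot a v                   ≡⟨ cong (λ x → v j + - (t * e p j) * x) av≡0 ⟩
      v j + - (t * e p j) * 0ℚ                        ≡⟨ solve 2 (λ x y → x :+ y :* con 0ℚ := x) refl (v j) (- (t * e p j)) ⟩
      v j                                             ∎
      where
      f : Fin (suc n) → ℚ
      f k = v k * (e k j - (t * a k) * e p j)

      f[p]≡0 : f p ≡ 0ℚ
      f[p]≡0 = begin
        v p * (e p j - (t * a p) * e p j)   ≡⟨ cong (λ y → v p * (e p j - y * e p j)) t*ap≡1 ⟩
        v p * (e p j - 1ℚ * e p j)          ≡⟨ solve 2 (λ x y → x :* (y :- con 1ℚ :* y) := con 0ℚ) refl (v p) (e p j) ⟩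
        0ℚ                                  ∎

      split : ∀ k → f k ≡ v k * e j k + - (t * e p j) * (a k * v k)
      split k = begin
        v k * (e k j - (t * a k) * e p j)                    ≡⟨ cong (λ y → v k * (y - (t * a k) * e p j)) (e-comm k j) ⟩
        v k * (e j k - (t * a k) * e p j)
          ≡⟨ solve 5 (λ v x t a y → v :* (x :- (t :* a) :* y) := v :* x :+ (:- (t :* y)) :* (a :* v))
                     refl (v k) (e j k) t (a k) (e p j) ⟩
        v k * e j k + - (t * e p j) * (a k * v k)            ∎

-- Elements of B_n

data Trit : ℚ → Set where
  t0 : Trit 0ℚ
  t+ : Trit 1ℚ
  t- : Trit (- 1ℚ)

Trit-* : ∀ {x y} → Trit x → Trit y → Trit (x * y)
Trit-* t0 t0 = t0
Trit-* t0 t+ = t0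
Trit-* t0 t- = t0
Trit-* t+ t0 = t0
Trit-* t+ t+ = t+
Trit-* t+ t- = t-
Trit-* t- t0 = t0
Trit-* t- t+ = t-
Trit-* t- t- = t+

InB-e⊕e : {i j : Fin n} → i ≢ j → {v : V n} → v ≗ e i ⊕ e j → InB v
InB-e⊕e {i = i} {j} i≢j v≗ei+ej with <-cmp i j
... | tri< i<j _ _ = inj₂ (i , j , i<j , inj₁ v≗ei+ej)
... | tri≈ _ i≡j _ = ⊥-elim (i≢j i≡j)
... | tri> _ _ j<i = inj₂ (j , i , j<i , inj₁ (λ k → trans (v≗ei+ej k) (⊕-comm (e i) (e j) k)))

InB-up-to-sign : {i j : Fin n} → i ≢ j → ∀ {c} → Trit c → ∃[ σ ] (σ * σ ≡ 1ℚ × InB (σ · (e i ⊖ (c · e j))))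
InB-up-to-sign {i = i} {j} _ t0 =
  1ℚ , refl , inj₁ (i , λ k → solve 2 (λ x y → con 1ℚ :* (x :- con 0ℚ :* y) := x) refl (e i k) (e j k))
InB-up-to-sign {i = i} {j} i≢j t- =
  1ℚ , refl , InB-e⊕e i≢j (λ k → solve 2 (λ x y → con 1ℚ :* (x :- con (- 1ℚ) :* y) := x :+ y) refl (e i k) (e j k))
InB-up-to-sign {i = i} {j} i≢j t+ with <-cmp i j
... | tri< i<j _ _ = 1ℚ , refl , inj₂ (i , j , i<j , inj₂ λ k →
  solve 2 (λ x y → con 1ℚ :* (x :- con 1ℚ :* y) := x :- y) refl (e i k) (e j k))
... | tri≈ _ i≡j _ = ⊥-elim (i≢j i≡j)
... | tri> _ _ j<i = - 1ℚ , refl , inj₂ (j , i , j<i , inj₂ λ k →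
  solve 2 (λ x y → con (- 1ℚ) :* (x :- con 1ℚ :* y) := y :- x) refl (e i k) (e j k))

kernel-admissible : (a : V (suc n)) (p : Fin (suc n)) → a p * a p ≡ 1ℚ → (∀ k → Trit (a k)) →
                    {W : Pred (suc n)} → (∀ v → W v ⇔ (dot a v ≡ 0ℚ)) → Admissible W
kernel-admissible {n} a p ap²≡1 trit W⇔ker =
  (a , (p , ap≢0) , λ v → ⇔.trans (W⇔ker v) (dot≡0⇔sumAll≡0 a v)) ,
  n , S , proj₂ ∘ proj₂ ∘ signed ,
  λ v → ⇔.trans (W⇔ker v)
          (mk⇔ (Span-rescale σ (proj₁ ∘ proj₂ ∘ signed) ∘ kernel⊆Span-kernelBasis a p (a p) ap²≡1)
               (Span⊆kernel a S⊆kernel))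
  where
  ap≢0 : a p ≢ 0ℚ
  ap≢0 ap≡0 = ℚ.1≢0 (trans (sym ap²≡1) (cong (λ x → x * x) ap≡0))

  signed : (k : Fin n) → ∃[ σ ] (σ * σ ≡ 1ℚ × InB (σ · kernelBasis a p (a p) k))
  signed k = InB-up-to-sign (punchInᵢ≢i p k) (Trit-* (trit p) (trit (punchIn p k)))

  σ : Fin n → ℚ
  σ = proj₁ ∘ signed

  S : Fin n → V (suc n)
  S k = σ k · kernelBasis a p (a p) k

  S⊆kernel : ∀ k → dot a (S k) ≡ 0ℚ
  S⊆kernel k = begin
    dot a (S k)                           ≡⟨ dot-· a (σ k) (kernelBasis a p (a p) k) ⟩
    σ k * dot a (kernelBasis a p (a p) k) ≡⟨ cong (σ k *_) (kernelBasis⊆kernel a p (a p) ap²≡1 k) ⟩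
    σ k * 0ℚ                              ≡⟨ ℚ.*-zeroʳ (σ k) ⟩
    0ℚ                                    ∎

-- The normal vector of H_P

indicator : Subset n → V n
indicator P k = if lookup P k then 1ℚ else 0ℚ

χ : Subset n → Subset n → V n
χ P⁺ P⁻ = indicator P⁺ ⊖ indicator P⁻

sumSub≡dot-indicator : (P : Subset n) (v : V n) → sumSub P v ≡ dot (indicator P) v
sumSub≡dot-indicator []          v = refl
sumSub≡dot-indicator (true ∷ P)  v =
  cong₂ _+_ (sym (ℚ.*-identityˡ (v zero))) (sumSub≡dot-indicator P (v ∘ suc))
sumSub≡dot-indicator (false ∷ P) v = begin
  sumSub P (v ∘ suc)                                  ≡⟨ sumSub≡dot-indicator P (v ∘ suc) ⟩
  dot (indicator P) (v ∘ suc)                         ≡⟨ ℚ.+-identityˡ _ ⟨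
  0ℚ + dot (indicator P) (v ∘ suc)                    ≡⟨ cong (_+ dot (indicator P) (v ∘ suc)) (ℚ.*-zeroˡ (v zero)) ⟨
  0ℚ * v zero + dot (indicator P) (v ∘ suc)           ∎

H⇔dot-χ≡0 : (P⁺ P⁻ : Subset n) (v : V n) → H P⁺ P⁻ v ⇔ (dot (χ P⁺ P⁻) v ≡ 0ℚ)
H⇔dot-χ≡0 P⁺ P⁻ v = mk⇔ (trans (sym lhs≡dot)) (trans lhs≡dot)
  where
  lhs≡dot : sumSub P⁺ v - sumSub P⁻ v ≡ dot (χ P⁺ P⁻) v
  lhs≡dot = begin
    sumSub P⁺ v - sumSub P⁻ v
      ≡⟨ cong₂ _-_ (sumSub≡dot-indicator P⁺ v) (sumSub≡dot-indicator P⁻ v) ⟩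
    dot (indicator P⁺) v - dot (indicator P⁻) v
      ≡⟨ cong₂ _-_ (dot-comm (indicator P⁺) v) (dot-comm (indicator P⁻) v) ⟩
    dot v (indicator P⁺) - dot v (indicator P⁻)        ≡⟨ dot-⊖ v (indicator P⁺) (indicator P⁻) ⟨
    dot v (χ P⁺ P⁻)                                    ≡⟨ dot-comm v (χ P⁺ P⁻) ⟩
    dot (χ P⁺ P⁻) v                                    ∎

data Position (P⁺ P⁻ : Subset n) (i : Fin n) : ℚ → Set where
  positive : i ∈ P⁺ → Position P⁺ P⁻ i 1ℚ
  negative : i ∈ P⁻ → Position P⁺ P⁻ i (- 1ℚ)
  neutral  : InZ P⁺ P⁻ i → Position P⁺ P⁻ i 0ℚ

module _ {P⁺ P⁻ : Subset n} (disjoint : Disjoint P⁺ P⁻) where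

  position : (i : Fin n) → Position P⁺ P⁻ i (χ P⁺ P⁻ i)
  position i with lookup P⁺ i in eq⁺ | lookup P⁻ i in eq⁻
  ... | true  | true  = ⊥-elim (disjoint i (lookup⇒[]= i P⁺ eq⁺ , lookup⇒[]= i P⁻ eq⁻))
  ... | true  | false = positive (lookup⇒[]= i P⁺ eq⁺)
  ... | false | true  = negative (lookup⇒[]= i P⁻ eq⁻)
  ... | false | false = neutral (lookup≡false⇒∉ eq⁺ , lookup≡false⇒∉ eq⁻)
    where
    lookup≡false⇒∉ : ∀ {P : Subset n} → lookup P i ≡ false → i ∉ P
    lookup≡false⇒∉ eq i∈P with () ← trans (sym ([]=⇒lookup i∈P)) eq

  Position-unique : ∀ {i x y} → Position P⁺ P⁻ i x → Position P⁺ P⁻ i y → x ≡ y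
  Position-unique (positive _)           (positive _)           = refl
  Position-unique (negative _)           (negative _)           = refl
  Position-unique (neutral _)            (neutral _)            = refl
  Position-unique (positive i∈P⁺)        (negative i∈P⁻)        = ⊥-elim (disjoint _ (i∈P⁺ , i∈P⁻))
  Position-unique (negative i∈P⁻)        (positive i∈P⁺)        = ⊥-elim (disjoint _ (i∈P⁺ , i∈P⁻))
  Position-unique (positive i∈P⁺)        (neutral (i∉P⁺ , _))   = ⊥-elim (i∉P⁺ i∈P⁺)
  Position-unique (neutral (i∉P⁺ , _))   (positive i∈P⁺)        = ⊥-elim (i∉P⁺ i∈P⁺)
  Position-unique (negative i∈P⁻)        (neutral (_ , i∉P⁻))   = ⊥-elim (i∉P⁻ i∈P⁻)
  Position-unique (neutral (_ , i∉P⁻))   (negative i∈P⁻)        = ⊥-elim (i∉P⁻ i∈P⁻)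

  χ-at : ∀ {i x} → Position P⁺ P⁻ i x → χ P⁺ P⁻ i ≡ x
  χ-at {i} = Position-unique (position i)

Position⇒Trit : ∀ {P⁺ P⁻ : Subset n} {i x} → Position P⁺ P⁻ i x → Trit x
Position⇒Trit (positive _) = t+
Position⇒Trit (negative _) = t-
Position⇒Trit (neutral _)  = t0

H-admissible : {P⁺ P⁻ : Subset n} → Disjoint P⁺ P⁻ → NotBothEmpty P⁺ P⁻ → Admissible (H P⁺ P⁻)
H-admissible {n = suc n} {P⁺} {P⁻} disjoint (p , p∈P±) =
  kernel-admissible (χ P⁺ P⁻) p χp²≡1 (Position⇒Trit ∘ position disjoint) (H⇔dot-χ≡0 P⁺ P⁻)
  where
  χp²≡1 : χ P⁺ P⁻ p * χ P⁺ P⁻ p ≡ 1ℚ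
  χp²≡1 = [ (λ p∈P⁺ → cong (λ x → x * x) (χ-at disjoint (positive p∈P⁺)))
          , (λ p∈P⁻ → cong (λ x → x * x) (χ-at disjoint (negative p∈P⁻))) ]′ p∈P±

module _ {P⁺ P⁻ : Subset n} (disjoint : Disjoint P⁺ P⁻) where

  private
    χ± : V n
    χ± = χ P⁺ P⁻

  dot-χ-e : ∀ {v i x} → v ≗ e i → Position P⁺ P⁻ i x → dot χ± v ≡ x
  dot-χ-e {i = i} v≗ei pi = trans (dot-cong χ± v≗ei) (trans (dot-e χ± i) (χ-at disjoint pi))

  dot-χ-e⊕e : ∀ {v i j x y} → v ≗ e i ⊕ e j → Position P⁺ P⁻ i x → Position P⁺ P⁻ j y → dot χ± v ≡ x + y
  dot-χ-e⊕e {i = i} {j} v≗ei+ej pi pj =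
    trans (dot-cong χ± v≗ei+ej) (trans (dot-e⊕e χ± i j) (cong₂ _+_ (χ-at disjoint pi) (χ-at disjoint pj)))

  dot-χ-e⊖e : ∀ {v i j x y} → v ≗ e i ⊖ e j → Position P⁺ P⁻ i x → Position P⁺ P⁻ j y → dot χ± v ≡ x - y
  dot-χ-e⊖e {i = i} {j} v≗ei-ej pi pj =
    trans (dot-cong χ± v≗ei-ej) (trans (dot-e⊖e χ± i j) (cong₂ _-_ (χ-at disjoint pi) (χ-at disjoint pj)))

  B∩H⊆BZ∪K : ∀ {v} → InB v → dot χ± v ≡ 0ℚ → InBZ P⁺ P⁻ v ⊎ InK P⁺ P⁻ v
  B∩H⊆BZ∪K {v} (inj₁ (i , v≗ei)) χv≡0 =
    from-e (position disjoint i) (trans (sym (dot-χ-e v≗ei (position disjoint i))) χv≡0)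
    where
    from-e : ∀ {x} → Position P⁺ P⁻ i x → x ≡ 0ℚ → InBZ P⁺ P⁻ v ⊎ InK P⁺ P⁻ v
    from-e (neutral i∈Z) _ = inj₁ (inj₁ (i , i∈Z , v≗ei))
    from-e (positive _) ()
    from-e (negative _) ()
  B∩H⊆BZ∪K {v} (inj₂ (i , j , i<j , inj₁ v≗ei+ej)) χv≡0 =
    from-e⊕e (position disjoint i) (position disjoint j)
             (trans (sym (dot-χ-e⊕e v≗ei+ej (position disjoint i) (position disjoint j))) χv≡0)
    where
    from-e⊕e : ∀ {x y} → Position P⁺ P⁻ i x → Position P⁺ P⁻ j y → x + y ≡ 0ℚ →
               InBZ P⁺ P⁻ v ⊎ InK P⁺ P⁻ v
    from-e⊕e (neutral i∈Z)   (neutral j∈Z)   _ = inj₁ (inj₂ (i , j , i<j , i∈Z , j∈Z , inj₁ v≗ei+ej))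
    from-e⊕e (positive i∈P⁺) (negative j∈P⁻) _ = inj₂ (inj₂ (inj₁ (i , j , i∈P⁺ , j∈P⁻ , v≗ei+ej)))
    from-e⊕e (negative i∈P⁻) (positive j∈P⁺) _ =
      inj₂ (inj₂ (inj₁ (j , i , j∈P⁺ , i∈P⁻ , λ k → trans (v≗ei+ej k) (⊕-comm (e i) (e j) k))))
    from-e⊕e (positive _) (positive _) ()
    from-e⊕e (positive _) (neutral _)  ()
    from-e⊕e (negative _) (negative _) ()
    from-e⊕e (negative _) (neutral _)  ()
    from-e⊕e (neutral _)  (positive _) ()
    from-e⊕e (neutral _)  (negative _) ()
  B∩H⊆BZ∪K {v} (inj₂ (i , j , i<j , inj₂ v≗ei-ej)) χv≡0 =
    from-e⊖e (position disjoint i) (position disjoint j)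
             (trans (sym (dot-χ-e⊖e v≗ei-ej (position disjoint i) (position disjoint j))) χv≡0)
    where
    from-e⊖e : ∀ {x y} → Position P⁺ P⁻ i x → Position P⁺ P⁻ j y → x - y ≡ 0ℚ →
               InBZ P⁺ P⁻ v ⊎ InK P⁺ P⁻ v
    from-e⊖e (neutral i∈Z)   (neutral j∈Z)   _ = inj₁ (inj₂ (i , j , i<j , i∈Z , j∈Z , inj₂ v≗ei-ej))
    from-e⊖e (positive i∈P⁺) (positive j∈P⁺) _ = inj₂ (inj₁ (i , j , i<j , i∈P⁺ , j∈P⁺ , v≗ei-ej))
    from-e⊖e (negative i∈P⁻) (negative j∈P⁻) _ = inj₂ (inj₂ (inj₂ (i , j , i<j , i∈P⁻ , j∈P⁻ , v≗ei-ej)))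
    from-e⊖e (positive _) (negative _) ()
    from-e⊖e (positive _) (neutral _)  ()
    from-e⊖e (negative _) (positive _) ()
    from-e⊖e (negative _) (neutral _)  ()
    from-e⊖e (neutral _)  (positive _) ()
    from-e⊖e (neutral _)  (negative _) ()

  BZ∪K⊆B∩H : ∀ {v} → InBZ P⁺ P⁻ v ⊎ InK P⁺ P⁻ v → InB v × dot χ± v ≡ 0ℚ
  BZ∪K⊆B∩H (inj₁ (inj₁ (i , i∈Z , v≗ei))) =
    inj₁ (i , v≗ei) , dot-χ-e v≗ei (neutral i∈Z)
  BZ∪K⊆B∩H (inj₁ (inj₂ (i , j , i<j , i∈Z , j∈Z , inj₁ v≗ei+ej))) =
    inj₂ (i , j , i<j , inj₁ v≗ei+ej) , dot-χ-e⊕e v≗ei+ej (neutral i∈Z) (neutral j∈Z)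
  BZ∪K⊆B∩H (inj₁ (inj₂ (i , j , i<j , i∈Z , j∈Z , inj₂ v≗ei-ej))) =
    inj₂ (i , j , i<j , inj₂ v≗ei-ej) , dot-χ-e⊖e v≗ei-ej (neutral i∈Z) (neutral j∈Z)
  BZ∪K⊆B∩H (inj₂ (inj₁ (i , j , i<j , i∈P⁺ , j∈P⁺ , v≗ei-ej))) =
    inj₂ (i , j , i<j , inj₂ v≗ei-ej) , dot-χ-e⊖e v≗ei-ej (positive i∈P⁺) (positive j∈P⁺)
  BZ∪K⊆B∩H (inj₂ (inj₂ (inj₁ (i , k , i∈P⁺ , k∈P⁻ , v≗ei+ek)))) =
    InB-e⊕e {i = i} {k} (λ { refl → disjoint i (i∈P⁺ , k∈P⁻) }) v≗ei+ek ,
    dot-χ-e⊕e v≗ei+ek (positive i∈P⁺) (negative k∈P⁻)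
  BZ∪K⊆B∩H (inj₂ (inj₂ (inj₂ (k , l , k<l , k∈P⁻ , l∈P⁻ , v≗ek-el)))) =
    inj₂ (k , l , k<l , inj₂ v≗ek-el) , dot-χ-e⊖e v≗ek-el (negative k∈P⁻) (negative l∈P⁻)

  B∩H⇔BZ∪K : ∀ v → (InB v × H P⁺ P⁻ v) ⇔ (InBZ P⁺ P⁻ v ⊎ InK P⁺ P⁻ v)
  B∩H⇔BZ∪K v = mk⇔ (λ (b , h) → B∩H⊆BZ∪K b (Equivalence.to (H⇔dot-χ≡0 P⁺ P⁻ v) h))
                   (map₂ (Equivalence.from (H⇔dot-χ≡0 P⁺ P⁻ v)) ∘ BZ∪K⊆B∩H)

-- Normal vectors of admissible hyperplanes

Odd : (ℚ → ℚ) → Set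
Odd g = ∀ x → g (- x) ≡ - g x

odd∘-preserves-B∩kernel : {g : ℚ → ℚ} → Odd g → (a : V n) →
                          ∀ {v} → InB v → dot a v ≡ 0ℚ → dot (g ∘ a) v ≡ 0ℚ
odd∘-preserves-B∩kernel {g = g} odd a {v} (inj₁ (i , v≗ei)) av≡0 = begin
  dot (g ∘ a) v  ≡⟨ trans (dot-cong (g ∘ a) v≗ei) (dot-e (g ∘ a) i) ⟩
  g (a i)        ≡⟨ cong g (trans (sym (trans (dot-cong a v≗ei) (dot-e a i))) av≡0) ⟩
  g 0ℚ           ≡⟨ x≡-x⇒x≡0 (odd 0ℚ) ⟩
  0ℚ             ∎
odd∘-preserves-B∩kernel {g = g} odd a {v} (inj₂ (i , j , _ , inj₁ v≗ei+ej)) av≡0 = begin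
  dot (g ∘ a) v        ≡⟨ trans (dot-cong (g ∘ a) v≗ei+ej) (dot-e⊕e (g ∘ a) i j) ⟩
  g (a i) + g (a j)    ≡⟨ cong (λ x → g (a i) + g x) aj≡-ai ⟩
  g (a i) + g (- a i)  ≡⟨ cong (g (a i) +_) (odd (a i)) ⟩
  g (a i) - g (a i)    ≡⟨ ℚ.+-inverseʳ (g (a i)) ⟩
  0ℚ                   ∎
  where
  aj≡-ai : a j ≡ - a i
  aj≡-ai = inverseʳ-unique (a i) (a j) (trans (sym (trans (dot-cong a v≗ei+ej) (dot-e⊕e a i j))) av≡0)
odd∘-preserves-B∩kernel {g = g} odd a {v} (inj₂ (i , j , _ , inj₂ v≗ei-ej)) av≡0 = begin
  dot (g ∘ a) v        ≡⟨ trans (dot-cong (g ∘ a) v≗ei-ej) (dot-e⊖e (g ∘ a) i j) ⟩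
  g (a i) - g (a j)    ≡⟨ cong (λ x → g x - g (a j)) ai≡aj ⟩
  g (a j) - g (a j)    ≡⟨ ℚ.+-inverseʳ (g (a j)) ⟩
  0ℚ                   ∎
  where
  ai≡aj : a i ≡ a j
  ai≡aj = x∙y⁻¹≈ε⇒x≈y (a i) (a j) (trans (sym (trans (dot-cong a v≗ei-ej) (dot-e⊖e a i j))) av≡0)

kernel⊆kernel⇒proportional : (a φ : V n) → (∀ v → dot a v ≡ 0ℚ → dot φ v ≡ 0ℚ) →
                             ∀ i j → a j * φ i ≡ a i * φ j
kernel⊆kernel⇒proportional {n} a φ ker-a⊆ker-φ i j =
  x∙y⁻¹≈ε⇒x≈y (a j * φ i) (a i * φ j) (trans (sym (dot-at φ)) (ker-a⊆ker-φ v av≡0))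
  where
  v : V n
  v = (a j · e i) ⊖ (a i · e j)

  dot-at : ∀ b → dot b v ≡ a j * b i - a i * b j
  dot-at b = trans (dot-⊖ b (a j · e i) (a i · e j))
                   (cong₂ _-_ (trans (dot-· b (a j) (e i)) (cong (a j *_) (dot-e b i)))
                              (trans (dot-· b (a i) (e j)) (cong (a i *_) (dot-e b j))))

  av≡0 : dot a v ≡ 0ℚ
  av≡0 = trans (dot-at a) (trans (cong (_- a i * a j) (ℚ.*-comm (a j) (a i))) (ℚ.+-inverseʳ (a i * a j)))

B-spanned-kernel⇒ratio : (a : V n) {S : Fin m → V n} → (∀ k → InB (S k)) → (∀ v → (dot a v ≡ 0ℚ) ⇔ Span S v) →
                         ∀ {i} → a i ≢ 0ℚ → ∀ j → ∃[ t ] (Trit t × a j ≡ a i * t)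
B-spanned-kernel⇒ratio a {S} S⊆B ker⇔Span {i} ai≢0 j with a i * a i ≟ℚ a j * a j
... | yes ai²≡aj² = [ (λ aj≡ai  → 1ℚ , t+ , trans aj≡ai (sym (ℚ.*-identityʳ (a i))))
                    , (λ aj≡-ai → - 1ℚ , t- , trans aj≡-ai (solve 1 (λ x → :- x := x :* con (- 1ℚ)) refl (a i))) ]′
                    (x*x≡y*y⇒x≡±y (sym ai²≡aj²))
... | no  ai²≢aj² = 0ℚ , t0 , trans aj≡0 (sym (ℚ.*-zeroʳ (a i)))
  where
  g : ℚ → ℚ
  g x = if does (x * x ≟ℚ a j * a j) then x else 0ℚ

  odd : Odd g
  odd x = begin
    g (- x)                                            ≡⟨ cong (λ y → if does (y ≟ℚ a j * a j) then - x else 0ℚ)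
                                                               (solve 1 (λ x → (:- x) :* (:- x) := x :* x) refl x) ⟩
    (if does (x * x ≟ℚ a j * a j) then - x else 0ℚ)    ≡⟨ negate-if (does (x * x ≟ℚ a j * a j)) ⟩
    - g x                                              ∎
    where
    negate-if : ∀ b → (if b then - x else 0ℚ) ≡ - (if b then x else 0ℚ)
    negate-if true  = refl
    negate-if false = refl

  ker-a⊆ker-g∘a : ∀ v → dot a v ≡ 0ℚ → dot (g ∘ a) v ≡ 0ℚ
  ker-a⊆ker-g∘a v av≡0 =
    Span⊆kernel (g ∘ a)
                (λ k → odd∘-preserves-B∩kernel odd a (S⊆B k) (Equivalence.from (ker⇔Span (S k)) (∈-Span S k)))
                (Equivalence.to (ker⇔Span v) av≡0)

  aj≡0 : a j ≡ 0ℚ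
  aj≡0 = x*y≡0⇒y≡0 ai≢0 (begin
    a i * a j      ≡⟨ cong (λ b → a i * (if b then a j else 0ℚ)) (dec-true (a j * a j ≟ℚ a j * a j) refl) ⟨
    a i * g (a j)  ≡⟨ kernel⊆kernel⇒proportional a (g ∘ a) ker-a⊆ker-g∘a i j ⟨
    a j * g (a i)  ≡⟨ cong (λ b → a j * (if b then a i else 0ℚ)) (dec-false (a i * a i ≟ℚ a j * a j) ai²≢aj²) ⟩
    a j * 0ℚ       ≡⟨ ℚ.*-zeroʳ (a j) ⟩
    0ℚ             ∎)

is-t+ is-t- : ∀ {x} → Trit x → Bool
is-t+ t+ = true
is-t+ _  = false
is-t- t- = true
is-t- _  = false

∈-tabulate⇒ : {f : Fin n → Bool} {i : Fin n} → i ∈ tabulate f → f i ≡ true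
∈-tabulate⇒ {f = f} {i} i∈ = trans (sym (lookup∘tabulate f i)) ([]=⇒lookup i∈)

module _ {t : V n} (τ : ∀ k → Trit (t k)) where

  plusSet minusSet : Subset n
  plusSet  = tabulate (is-t+ ∘ τ)
  minusSet = tabulate (is-t- ∘ τ)

  sign-sets-disjoint : Disjoint plusSet minusSet
  sign-sets-disjoint i (i∈P⁺ , i∈P⁻) = not-both (τ i) (∈-tabulate⇒ i∈P⁺) (∈-tabulate⇒ i∈P⁻)
    where
    not-both : ∀ {x} (τx : Trit x) → is-t+ τx ≡ true → is-t- τx ≡ true → ⊥
    not-both t0 ()
    not-both t+ _ ()
    not-both t- ()

  t≗χ-sign-sets : t ≗ χ plusSet minusSet
  t≗χ-sign-sets k = trans (value (τ k))
    (cong₂ (λ b c → (if b then 1ℚ else 0ℚ) - (if c then 1ℚ else 0ℚ))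
           (sym (lookup∘tabulate (is-t+ ∘ τ) k)) (sym (lookup∘tabulate (is-t- ∘ τ) k)))
    where
    value : ∀ {x} (τx : Trit x) → x ≡ (if is-t+ τx then 1ℚ else 0ℚ) - (if is-t- τx then 1ℚ else 0ℚ)
    value t0 = refl
    value t+ = refl
    value t- = refl

multiple-of-χ-kernel⇔H : ∀ {x} {a : V n} {P⁺ P⁻ : Subset n} → x ≢ 0ℚ → (∀ k → a k ≡ x * χ P⁺ P⁻ k) →
                  ∀ v → (dot a v ≡ 0ℚ) ⇔ H P⁺ P⁻ v
multiple-of-χ-kernel⇔H {x = x} {a} {P⁺} {P⁻} x≢0 a≡x·χ v =
  ⇔.trans (mk⇔ (x*y≡0⇒y≡0 x≢0 ∘ trans (sym av≡x·χv))
               (λ χv≡0 → trans av≡x·χv (trans (cong (x *_) χv≡0) (ℚ.*-zeroʳ x))))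
          (⇔.sym (H⇔dot-χ≡0 P⁺ P⁻ v))
  where
  av≡x·χv : dot a v ≡ x * dot (χ P⁺ P⁻) v
  av≡x·χv = begin
    sum (λ k → a k * v k)
      ≡⟨ sum-cong-≗ (λ k → trans (cong (_* v k) (a≡x·χ k)) (ℚ.*-assoc x (χ P⁺ P⁻ k) (v k))) ⟩
    sum (λ k → x * (χ P⁺ P⁻ k * v k))      ≡⟨ *-distribˡ-sum x (λ k → χ P⁺ P⁻ k * v k) ⟨
    x * dot (χ P⁺ P⁻) v                    ∎

χ≢0⇒NotBothEmpty : {P⁺ P⁻ : Subset n} → Disjoint P⁺ P⁻ → ∀ {i} → χ P⁺ P⁻ i ≢ 0ℚ → NotBothEmpty P⁺ P⁻
χ≢0⇒NotBothEmpty {P⁺ = P⁺} {P⁻} disjoint {i} χi≢0 = i , member (position disjoint i) χi≢0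
  where
  member : ∀ {x} → Position P⁺ P⁻ i x → x ≢ 0ℚ → i ∈ P⁺ ⊎ i ∈ P⁻
  member (positive i∈P⁺) _   = inj₁ i∈P⁺
  member (negative i∈P⁻) _   = inj₂ i∈P⁻
  member (neutral _)     0≢0 = ⊥-elim (0≢0 refl)

admissible⇒H : {W : Pred n} → Admissible W →
               ∃[ P⁺ ] ∃[ P⁻ ] (Disjoint P⁺ P⁻ × NotBothEmpty P⁺ P⁻ × (∀ v → W v ⇔ H P⁺ P⁻ v))
admissible⇒H {W = W} ((a , (i , ai≢0) , W⇔sumAll≡0) , _ , S , S⊆B , W⇔Span) =
  plusSet τ , minusSet τ , sign-sets-disjoint τ , χ≢0⇒NotBothEmpty (sign-sets-disjoint τ) χi≢0 ,
  λ v → ⇔.trans (W⇔ker v) (multiple-of-χ-kernel⇔H {P⁺ = plusSet τ} {minusSet τ} ai≢0 a≡ai·χ v)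
  where
  W⇔ker : ∀ v → W v ⇔ (dot a v ≡ 0ℚ)
  W⇔ker v = ⇔.trans (W⇔sumAll≡0 v) (⇔.sym (dot≡0⇔sumAll≡0 a v))

  ratio : ∀ j → ∃[ t ] (Trit t × a j ≡ a i * t)
  ratio = B-spanned-kernel⇒ratio a S⊆B (λ v → ⇔.trans (⇔.sym (W⇔ker v)) (W⇔Span v)) ai≢0

  τ : ∀ j → Trit (proj₁ (ratio j))
  τ j = proj₁ (proj₂ (ratio j))

  a≡ai·χ : ∀ j → a j ≡ a i * χ (plusSet τ) (minusSet τ) j
  a≡ai·χ j = trans (proj₂ (proj₂ (ratio j))) (cong (a i *_) (t≗χ-sign-sets τ j))

  χi≢0 : χ (plusSet τ) (minusSet τ) i ≢ 0ℚ
  χi≢0 χi≡0 = ai≢0 (trans (a≡ai·χ i) (trans (cong (a i *_) χi≡0) (ℚ.*-zeroʳ (a i))))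

lemma8p6 : (n : ℕ) → 1 ≤ n →
    ((P⁺ P⁻ : Subset n) → Disjoint P⁺ P⁻ → NotBothEmpty P⁺ P⁻ →
        Admissible (H P⁺ P⁻)
      × (∀ (v : V n) → (InB v × H P⁺ P⁻ v) ⇔ (InBZ P⁺ P⁻ v ⊎ InK P⁺ P⁻ v)))
    × ((W : Pred n) → Admissible W →
        ∃[ P⁺ ] ∃[ P⁻ ] (Disjoint P⁺ P⁻ × NotBothEmpty P⁺ P⁻
          × (∀ (v : V n) → W v ⇔ H P⁺ P⁻ v)))
-- The hypothesis 1 ≤ n is implied by NotBothEmpty P⁺ P⁻, resp. by the nonzero normal of W.
lemma8p6 n _ =
  (λ P⁺ P⁻ disjoint notBothEmpty → H-admissible disjoint notBothEmpty , B∩H⇔BZ∪K disjoint) ,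
  (λ W → admissible⇒H)
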